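{- Let $G$ be a finite simple graph without isolated vertices and $n=|V(G)|$. Then $Z(G)\le n-\gamma(G)$.
   Context: $\gamma(G)$ is the domination number: the minimum size of a set $X\subseteq V(G)$ such that every vertex outside $X$ has a neighbor in $X$. $Z(G)$ is the zero forcing number: the minimum size of a set $B$ of initially blue vertices (others white) such that repeatedly applying the rule "if $y$ is a neighbor of $x$ and all vertices of the closed neighborhood $N[x]$ are blue except $y$, then $y$ turns blue" eventually makes all vertices blue. -}

module Defs where

open import Data.Nat using (ℕ; _≤_)
open import Data.Fin using (Fin)
open import Data.Fin.Subset using (Subset; _∈_; _∉_; ∣_∣)
open import Data.Product using (Σ; ∃; _×_)
open import Data.Sum using (_⊎_)
open import Relation.Binary.PropositionalEquality using (_≡_)
open import Relation.Nullary using (¬_)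

record Graph (n : ℕ) : Set₁ where
  field
    Adj   : Fin n → Fin n → Set
    sym   : ∀ {u v} → Adj u v → Adj v u
    irrfl : ∀ {v} → ¬ Adj v v
open Graph public

NoIsolated : ∀ {n} → Graph n → Set
NoIsolated {n} G = (v : Fin n) → ∃ λ u → Adj G v u

InClosedNbhd : ∀ {n} → Graph n → Fin n → Fin n → Set
InClosedNbhd G x w = (w ≡ x) ⊎ Adj G x w

IsDominating : ∀ {n} → Graph n → Subset n → Set
IsDominating {n} G X = (v : Fin n) → v ∉ X → ∃ λ u → u ∈ X × Adj G u v

IsDominationNumber : ∀ {n} → Graph n → ℕ → Set
IsDominationNumber {n} G k =
  (Σ (Subset n) λ X → IsDominating G X × ∣ X ∣ ≡ k)
  × ((X : Subset n) → IsDominating G X → k ≤ ∣ X ∣)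

-- Vertices that eventually become blue from the initial blue set B under the
-- zero forcing colour-change rule (the rule is monotone, so the final colouring
-- is the least set closed under it).
data Blue {n : ℕ} (G : Graph n) (B : Subset n) : Fin n → Set where
  initial : ∀ {v} → v ∈ B → Blue G B v
  force   : ∀ {x y} → Adj G x y →
            ((w : Fin n) → InClosedNbhd G x w → ¬ (w ≡ y) → Blue G B w) →
            Blue G B y

IsZeroForcingSet : ∀ {n} → Graph n → Subset n → Set
IsZeroForcingSet {n} G B = (v : Fin n) → Blue G B v

IsZeroForcingNumber : ∀ {n} → Graph n → ℕ → Set
IsZeroForcingNumber {n} G k =
  (Σ (Subset n) λ B → IsZeroForcingSet G B × ∣ B ∣ ≡ k)
  × ((B : Subset n) → IsZeroForcingSet G B → k ≤ ∣ B ∣)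

module Submission where

-- Let D be a minimum dominating set in which every vertex d has an external
-- private neighbour p(d): a vertex outside D adjacent to d and to no other
-- vertex of D.  Put W = p[D] and B = V ∖ W.  Every w = p(d) ∈ W is forced by d,
-- because all other vertices of N[d] lie outside W; so B is a zero forcing
-- set, and since p is injective on D, |B| = n - |W| ≤ n - |D| = n - γ(G).
--
-- Such a D exists when G has no isolated vertices (Bollobás–Cockayne): if
-- d ∈ D has no external private neighbour, minimality forces d to have no
-- neighbour in D, and replacing d by any neighbour u of d gives a minimum
-- dominating set with strictly more vertices that have a neighbour inside
-- the set.
--
-- The exchange argument decides adjacency.  Adjacency in Defs.Graph is not
-- assumed decidable, but the goal z ≤ n ∸ g is decidable, so it suffices to
-- prove it under the (doubly negated, hence harmless) hypothesis that
-- adjacency on the finite vertex set is decidable.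

open import Defs hiding (sym)
open import Data.Empty using (⊥-elim)
open import Data.Fin using (Fin; zero; suc; _≟_)
open import Data.Fin.Properties using (any?; all?; ¬∀⟶∃¬; suc-injective; 0≢1+n; sequence)
open import Data.Fin.Subset
  using (Subset; _∈_; _∉_; _⊆_; _⊂_; ∣_∣; _─_; _-_; _∪_; ⁅_⁆; ∁; inside; outside)
open import Data.Fin.Subset.Properties
  using ( _∈?_; p─⊥≡p; p─q⊆p; x∈p∧x≢y⇒x∈p-y; x∉⁅y⁆⇒x≢y; x∈⁅x⁆; x∈⁅y⁆⇒x≡y
        ; x∈p∪q⁺; x∈p∪q⁻; p⊆q⇒∣p∣≤∣q∣; p⊂q⇒∣p∣<∣q∣; p⊂q⇒∁p⊃∁q; x∈p⇒∣p-x∣<∣p∣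
        ; x∉p⇒x∈∁p; ∣∁p∣≡n∸∣p∣ )
open import Data.Nat using (ℕ; suc; _≤_; _<_; _∸_; z≤n; s≤s; _≤?_)
open import Data.Nat.Induction using (<-wellFounded)
open import Data.Nat.Properties using (≤-trans; <⇒≱; ∸-monoʳ-≤; module ≤-Reasoning)
open import Data.Product using (Σ; ∃; _×_; _,_; proj₁; proj₂)
open import Data.Sum using (_⊎_; inj₁; inj₂)
open import Data.Vec using ([]; _∷_; tabulate; here; there)
open import Data.Vec.Properties using (lookup∘tabulate; []=⇒lookup; lookup⇒[]=)
open import Effect.Monad using (RawMonad)
open import Function using (_∘_)
open import Induction.WellFounded using (Acc; acc)
open import Relation.Binary.PropositionalEquality
  using (_≡_; _≢_; refl; sym; trans; cong; subst)
open import Relation.Nullary using (¬_; Dec; yes; no; does; contradiction)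
open import Relation.Nullary.Decidable
  using (dec-true; decidable-stable; ¬¬-excluded-middle; ¬?; _×-dec_; _→-dec_)
open import Relation.Nullary.Negation using (¬¬-Monad; ¬¬-map)
open import Relation.Unary using (Decidable)

∈-remove⁻ : ∀ {n} {x y : Fin n} (p : Subset n) → x ∈ p - y → x ∈ p × x ≢ y
∈-remove⁻ {y = y} p x∈p-y = p─q⊆p p ⁅ y ⁆ x∈p-y , x∉⁅y⁆⇒x≢y (outside-removed p ⁅ y ⁆ x∈p-y)
  where
  outside-removed : ∀ {n} {x : Fin n} (p q : Subset n) → x ∈ p ─ q → x ∉ q
  outside-removed (_ ∷ p) (outside ∷ q) (there x∈) (there x∈q) = outside-removed p q x∈ x∈q
  outside-removed (_ ∷ p) (inside ∷ q)  (there x∈) (there x∈q) = outside-removed p q x∈ x∈q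

∣p∣≡1+∣p-x∣ : ∀ {n} {x : Fin n} (p : Subset n) → x ∈ p → ∣ p ∣ ≡ suc ∣ p - x ∣
∣p∣≡1+∣p-x∣ (inside ∷ p)  here        = cong (suc ∘ ∣_∣) (sym (p─⊥≡p p))
∣p∣≡1+∣p-x∣ (inside ∷ p)  (there x∈p) = cong suc (∣p∣≡1+∣p-x∣ p x∈p)
∣p∣≡1+∣p-x∣ (outside ∷ p) (there x∈p) = ∣p∣≡1+∣p-x∣ p x∈p

∣p∪⁅x⁆∣≤1+∣p∣ : ∀ {n} (p : Subset n) (x : Fin n) → ∣ p ∪ ⁅ x ⁆ ∣ ≤ suc ∣ p ∣
∣p∪⁅x⁆∣≤1+∣p∣ p x = begin
  ∣ p ∪ ⁅ x ⁆ ∣            ≡⟨ ∣p∣≡1+∣p-x∣ (p ∪ ⁅ x ⁆) (x∈p∪q⁺ (inj₂ (x∈⁅x⁆ x))) ⟩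
  suc ∣ p ∪ ⁅ x ⁆ - x ∣    ≤⟨ s≤s (p⊆q⇒∣p∣≤∣q∣ rest⊆p) ⟩
  suc ∣ p ∣                ∎
  where
  open ≤-Reasoning
  rest⊆p : p ∪ ⁅ x ⁆ - x ⊆ p
  rest⊆p y∈ with ∈-remove⁻ (p ∪ ⁅ x ⁆) y∈
  ... | y∈p∪x , y≢x with x∈p∪q⁻ p ⁅ x ⁆ y∈p∪x
  ...   | inj₁ y∈p = y∈p
  ...   | inj₂ y∈x = contradiction (x∈⁅y⁆⇒x≡y x y∈x) y≢x

injection⇒∣S∣≤∣T∣ : ∀ {m n} (f : Fin m → Fin n) (S : Subset m) (T : Subset n) →
  (∀ {x} → x ∈ S → f x ∈ T) →
  (∀ {x y} → x ∈ S → y ∈ S → f x ≡ f y → x ≡ y) →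
  ∣ S ∣ ≤ ∣ T ∣
injection⇒∣S∣≤∣T∣ f [] T maps inj = z≤n
injection⇒∣S∣≤∣T∣ f (outside ∷ S) T maps inj =
  injection⇒∣S∣≤∣T∣ (f ∘ suc) S T (maps ∘ there)
    (λ x∈S y∈S → suc-injective ∘ inj (there x∈S) (there y∈S))
injection⇒∣S∣≤∣T∣ f (inside ∷ S) T maps inj = begin
  suc ∣ S ∣               ≤⟨ s≤s (injection⇒∣S∣≤∣T∣ (f ∘ suc) S (T - f zero) maps′ inj′) ⟩
  suc ∣ T - f zero ∣      ≡⟨ sym (∣p∣≡1+∣p-x∣ T (maps here)) ⟩
  ∣ T ∣                   ∎
  where
  open ≤-Reasoning
  maps′ : ∀ {x} → x ∈ S → f (suc x) ∈ T - f zero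
  maps′ x∈S = x∈p∧x≢y⇒x∈p-y (maps (there x∈S)) (0≢1+n ∘ inj here (there x∈S) ∘ sym)
  inj′ : ∀ {x y} → x ∈ S → y ∈ S → f (suc x) ≡ f (suc y) → x ≡ y
  inj′ x∈S y∈S = suc-injective ∘ inj (there x∈S) (there y∈S)

subsetOf : ∀ {n} {P : Fin n → Set} → Decidable P → Subset n
subsetOf P? = tabulate (does ∘ P?)

∈-subsetOf⁺ : ∀ {n} {P : Fin n → Set} (P? : Decidable P) {x} → P x → x ∈ subsetOf P?
∈-subsetOf⁺ P? {x} px = lookup⇒[]= x (subsetOf P?) (trans (lookup∘tabulate (does ∘ P?) x) (dec-true (P? x) px))

∈-subsetOf⁻ : ∀ {n} {P : Fin n → Set} (P? : Decidable P) {x} → x ∈ subsetOf P? → P x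
∈-subsetOf⁻ P? {x} x∈ with P? x | trans (sym (lookup∘tabulate (does ∘ P?) x)) ([]=⇒lookup x∈)
... | yes px | _ = px
... | no _   | ()

InImage : ∀ {m n} → (Fin m → Fin n) → Subset m → Fin n → Set
InImage f S v = ∃ λ x → x ∈ S × f x ≡ v

inImage? : ∀ {m n} (f : Fin m → Fin n) (S : Subset m) → Decidable (InImage f S)
inImage? f S v = any? (λ x → (x ∈? S) ×-dec (f x ≟ v))

image : ∀ {m n} → (Fin m → Fin n) → Subset m → Subset n
image f S = subsetOf (inImage? f S)

∈-image⁺ : ∀ {m n} (f : Fin m → Fin n) {S x} → x ∈ S → f x ∈ image f S
∈-image⁺ f {S} {x} x∈S = ∈-subsetOf⁺ (inImage? f S) (x , x∈S , refl)

∈-image⁻ : ∀ {m n} (f : Fin m → Fin n) {S v} → v ∈ image f S → InImage f S v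
∈-image⁻ f {S} = ∈-subsetOf⁻ (inImage? f S)

allOrCounterexample : ∀ {n} {P Q : Fin n → Set} → Decidable P → Decidable Q →
  (∀ x → P x → Q x) ⊎ ∃ λ x → P x × ¬ Q x
allOrCounterexample {n} P? Q? with all? (λ x → P? x →-dec Q? x)
... | yes always = inj₁ always
... | no ¬always with ¬∀⟶∃¬ n _ (λ x → P? x →-dec Q? x) ¬always
...   | x , ¬[P→Q] = inj₂ (x , decidable-stable (P? x) (λ ¬p → ¬[P→Q] (⊥-elim ∘ ¬p)) , λ q → ¬[P→Q] (λ _ → q))

module _ {n : ℕ} (G : Graph n) where

  PrivateNeighbour : Subset n → Fin n → Fin n → Set
  PrivateNeighbour D d v = v ∉ D × Adj G d v × ((d′ : Fin n) → d′ ∈ D → Adj G d′ v → d′ ≡ d)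

  HasPrivateNeighbour : Subset n → Fin n → Set
  HasPrivateNeighbour D d = ∃ (PrivateNeighbour D d)

  IsMinimumDominating : Subset n → Set
  IsMinimumDominating D = IsDominating G D × ((X : Subset n) → IsDominating G X → ∣ D ∣ ≤ ∣ X ∣)

  module PrivateNeighbourForcing (D : Subset n)
         (hasPrivate : ∀ {d} → d ∈ D → HasPrivateNeighbour D d) where

    pn : Fin n → Fin n
    pn d with d ∈? D
    ... | yes d∈D = proj₁ (hasPrivate d∈D)
    ... | no _    = d

    pn-private : ∀ {d} → d ∈ D → PrivateNeighbour D d (pn d)
    pn-private {d} d∈D with d ∈? D
    ... | yes d∈D′ = proj₂ (hasPrivate d∈D′)
    ... | no d∉D   = contradiction d∈D d∉D

    pn-injective : ∀ {x y} → x ∈ D → y ∈ D → pn x ≡ pn y → x ≡ y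
    pn-injective x∈D y∈D pnx≡pny =
      proj₂ (proj₂ (pn-private y∈D)) _ x∈D (subst (Adj G _) pnx≡pny (proj₁ (proj₂ (pn-private x∈D))))

    W : Subset n
    W = image pn D

    -- N[d] ∖ {pn d} avoids W: d itself is in D, and a neighbour pn d′ of d
    -- is private to d′, so d′ = d.
    closedNbhd-outside-W : ∀ {d w} → d ∈ D → InClosedNbhd G d w → w ≢ pn d → w ∉ W
    closedNbhd-outside-W d∈D w∈N[d] w≢pnd w∈W with ∈-image⁻ pn w∈W
    closedNbhd-outside-W d∈D (inj₁ refl) w≢pnd w∈W | d′ , d′∈D , pnd′≡d =
      proj₁ (pn-private d′∈D) (subst (_∈ D) (sym pnd′≡d) d∈D)
    closedNbhd-outside-W d∈D (inj₂ d~pnd′) w≢pnd w∈W | d′ , d′∈D , refl =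
      w≢pnd (cong pn (sym (proj₂ (proj₂ (pn-private d′∈D)) _ d∈D d~pnd′)))

    -- each pn d is forced by d in one step
    ∁W-zeroForcing : IsZeroForcingSet G (∁ W)
    ∁W-zeroForcing v with v ∈? W
    ... | no v∉W = initial (x∉p⇒x∈∁p v∉W)
    ... | yes v∈W with ∈-image⁻ pn v∈W
    ...   | d , d∈D , refl = force (proj₁ (proj₂ (pn-private d∈D)))
              (λ w w∈N[d] w≢pnd → initial (x∉p⇒x∈∁p (closedNbhd-outside-W d∈D w∈N[d] w≢pnd)))

    ∣∁W∣≤n∸∣D∣ : ∣ ∁ W ∣ ≤ n ∸ ∣ D ∣
    ∣∁W∣≤n∸∣D∣ = begin
      ∣ ∁ W ∣   ≡⟨ ∣∁p∣≡n∸∣p∣ W ⟩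
      n ∸ ∣ W ∣ ≤⟨ ∸-monoʳ-≤ n (injection⇒∣S∣≤∣T∣ pn D W (∈-image⁺ pn) pn-injective) ⟩
      n ∸ ∣ D ∣ ∎
      where open ≤-Reasoning

  zeroForcingFromPrivateNeighbours : (D : Subset n) →
    (∀ {d} → d ∈ D → HasPrivateNeighbour D d) →
    Σ (Subset n) λ B → IsZeroForcingSet G B × ∣ B ∣ ≤ n ∸ ∣ D ∣
  zeroForcingFromPrivateNeighbours D hasPrivate = ∁ W , ∁W-zeroForcing , ∣∁W∣≤n∸∣D∣
    where open PrivateNeighbourForcing D hasPrivate

module Exchange {n : ℕ} (G : Graph n) (adj? : ∀ x y → Dec (Adj G x y)) where

  Dominates : Subset n → Fin n → Set
  Dominates X v = ∃ λ u → u ∈ X × Adj G u v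

  dominates? : ∀ X → Decidable (Dominates X)
  dominates? X v = any? (λ u → (u ∈? X) ×-dec adj? u v)

  privateNeighbour? : ∀ D d → Decidable (PrivateNeighbour G D d)
  privateNeighbour? D d v =
    ¬? (v ∈? D) ×-dec adj? d v ×-dec all? (λ d′ → (d′ ∈? D) →-dec (adj? d′ v →-dec (d′ ≟ d)))

  hasPrivateNeighbour? : ∀ D → Decidable (HasPrivateNeighbour G D)
  hasPrivateNeighbour? D d = any? (privateNeighbour? D d)

  -- Members of D having a neighbour in D; the exchange enlarges this set.
  InnerDominated : Subset n → Fin n → Set
  InnerDominated D x = x ∈ D × Dominates D x

  innerDominated? : ∀ D → Decidable (InnerDominated D)
  innerDominated? D x = (x ∈? D) ×-dec dominates? D x

  innerDominated : Subset n → Subset n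
  innerDominated D = subsetOf (innerDominated? D)

  sharedNeighbour : ∀ {D d x} → x ∉ D → Adj G d x → ¬ PrivateNeighbour G D d x →
    Dominates (D - d) x
  sharedNeighbour {D} {d} {x} x∉D d~x notPrivate
    with allOrCounterexample (λ d′ → (d′ ∈? D) ×-dec adj? d′ x) (_≟ d)
  ... | inj₁ onlyD = contradiction (x∉D , d~x , λ d′ d′∈D d′~x → onlyD d′ (d′∈D , d′~x)) notPrivate
  ... | inj₂ (d′ , (d′∈D , d′~x) , d′≢d) = d′ , x∈p∧x≢y⇒x∈p-y d′∈D d′≢d , d′~x

  -- In a minimum dominating set, a vertex without an external private
  -- neighbour has no neighbour in the set: otherwise D - d still dominates.
  noPrivate⇒isolated : ∀ {D d} → IsMinimumDominating G D → d ∈ D → ¬ HasPrivateNeighbour G D d →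
    ∀ {y} → y ∈ D → ¬ Adj G y d
  noPrivate⇒isolated {D} {d} (D-dom , D-min) d∈D noPrivate {y} y∈D y~d = D-d-not-dominating D-d-dom
    where
    D-d-not-dominating : ¬ IsDominating G (D - d)
    D-d-not-dominating dom = contradiction (D-min (D - d) dom) (<⇒≱ (x∈p⇒∣p-x∣<∣p∣ d∈D))
    y≢d : y ≢ d
    y≢d refl = irrfl G y~d
    -- d is dominated by y; anything dominated only by d is non-private.
    D-d-dom : IsDominating G (D - d)
    D-d-dom v v∉D-d with v ≟ d | v ∈? D
    ... | yes refl | _      = y , x∈p∧x≢y⇒x∈p-y y∈D y≢d , y~d
    ... | no v≢d   | yes v∈D = contradiction (x∈p∧x≢y⇒x∈p-y v∈D v≢d) v∉D-d
    ... | no v≢d   | no v∉D with D-dom v v∉D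
    ...   | u , u∈D , u~v with u ≟ d
    ...     | no u≢d  = u , x∈p∧x≢y⇒x∈p-y u∈D u≢d , u~v
    ...     | yes refl = sharedNeighbour v∉D u~v (noPrivate ∘ (v ,_))

  module Swap {D : Subset n} {d u : Fin n} (D-min : IsMinimumDominating G D) (d∈D : d ∈ D)
         (noPrivate : ¬ HasPrivateNeighbour G D d) (d~u : Adj G d u) where

    D′ : Subset n
    D′ = (D - d) ∪ ⁅ u ⁆

    isolated : ∀ {y} → y ∈ D → ¬ Adj G y d
    isolated = noPrivate⇒isolated D-min d∈D noPrivate

    u∉D : u ∉ D
    u∉D u∈D = isolated u∈D (Graph.sym G d~u)

    kept : ∀ {x} → x ∈ D → x ≢ d → x ∈ D′
    kept x∈D x≢d = x∈p∪q⁺ (inj₁ (x∈p∧x≢y⇒x∈p-y x∈D x≢d))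

    u∈D′ : u ∈ D′
    u∈D′ = x∈p∪q⁺ (inj₂ (x∈⁅x⁆ u))

    -- d is dominated by u; a vertex formerly dominated only by d is a
    -- non-private neighbour of d, hence dominated by D - d.
    D′-dominating : IsDominating G D′
    D′-dominating v v∉D′ with v ≟ d | v ∈? D
    ... | yes refl | _       = u , u∈D′ , Graph.sym G d~u
    ... | no v≢d   | yes v∈D = contradiction (kept v∈D v≢d) v∉D′
    ... | no v≢d   | no v∉D with proj₁ D-min v v∉D
    ...   | w , w∈D , w~v with w ≟ d
    ...     | no w≢d   = w , kept w∈D w≢d , w~v
    ...     | yes refl with sharedNeighbour v∉D w~v (noPrivate ∘ (v ,_))
    ...       | w′ , w′∈D-d , w′~v = w′ , x∈p∪q⁺ (inj₁ w′∈D-d) , w′~v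

    ∣D′∣≤∣D∣ : ∣ D′ ∣ ≤ ∣ D ∣
    ∣D′∣≤∣D∣ = begin
      ∣ D′ ∣         ≤⟨ ∣p∪⁅x⁆∣≤1+∣p∣ (D - d) u ⟩
      suc ∣ D - d ∣  ≡⟨ sym (∣p∣≡1+∣p-x∣ D d∈D) ⟩
      ∣ D ∣          ∎
      where open ≤-Reasoning

    D′-minimum : IsMinimumDominating G D′
    D′-minimum = D′-dominating , λ X X-dom → ≤-trans ∣D′∣≤∣D∣ (proj₂ D-min X X-dom)

    -- Inner vertices of D stay inner (neither they nor their neighbour is d,
    -- as d is isolated in D), and u becomes inner, being non-private to d.
    innerDominated-grows : innerDominated D ⊂ innerDominated D′
    innerDominated-grows = stays , u , ∈-subsetOf⁺ (innerDominated? D′) u-inner , u∉D ∘ proj₁ ∘ ∈-subsetOf⁻ (innerDominated? D)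
      where
      stays : innerDominated D ⊆ innerDominated D′
      stays x∈ with ∈-subsetOf⁻ (innerDominated? D) x∈
      ... | x∈D , y , y∈D , y~x = ∈-subsetOf⁺ (innerDominated? D′)
        (kept x∈D (λ { refl → isolated y∈D y~x }) , y , kept y∈D (λ { refl → isolated x∈D (Graph.sym G y~x) }) , y~x)
      u-inner : InnerDominated D′ u
      u-inner with sharedNeighbour u∉D d~u (noPrivate ∘ (u ,_))
      ... | w , w∈D-d , w~u = u∈D′ , w , x∈p∪q⁺ (inj₁ w∈D-d) , w~u

  -- Exchanges
  -- shrink the complement of the set of inner vertices, so they terminate.
  privateMinimumDominating : NoIsolated G → (D : Subset n) → IsMinimumDominating G D →
    Σ (Subset n) λ D → IsMinimumDominating G D × (∀ {d} → d ∈ D → HasPrivateNeighbour G D d)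
  privateMinimumDominating noIsolated D D-min = improve D D-min (<-wellFounded _)
    where
    improve : ∀ D → IsMinimumDominating G D → Acc _<_ ∣ ∁ (innerDominated D) ∣ →
      Σ (Subset n) λ D → IsMinimumDominating G D × (∀ {d} → d ∈ D → HasPrivateNeighbour G D d)
    improve D D-min (acc smaller) with allOrCounterexample (_∈? D) (hasPrivateNeighbour? D)
    ... | inj₁ allPrivate = D , D-min , allPrivate _
    ... | inj₂ (d , d∈D , noPrivate) =
      improve D′ D′-minimum (smaller (p⊂q⇒∣p∣<∣q∣ (p⊂q⇒∁p⊃∁q innerDominated-grows)))
      where open Swap D-min d∈D noPrivate (proj₂ (noIsolated d))

adjacency-¬¬decidable : ∀ {n} (G : Graph n) → ¬ ¬ (∀ x y → Dec (Adj G x y))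
adjacency-¬¬decidable G =
  sequence ¬¬-applicative (λ x → sequence ¬¬-applicative (λ y → ¬¬-excluded-middle))
  where ¬¬-applicative = RawMonad.rawApplicative ¬¬-Monad

proposition2p4 : (n : ℕ) (G : Graph n) → NoIsolated G →
    (z g : ℕ) → IsZeroForcingNumber G z → IsDominationNumber G g →
    z ≤ n ∸ g
proposition2p4 n G noIsolated z g (_ , zMin) ((D₀ , D₀-dom , ∣D₀∣≡g) , γMin) =
  decidable-stable (z ≤? n ∸ g) (¬¬-map bound (adjacency-¬¬decidable G))
  where
  D₀-minimum : IsMinimumDominating G D₀
  D₀-minimum = D₀-dom , λ X X-dom → subst (_≤ ∣ X ∣) (sym ∣D₀∣≡g) (γMin X X-dom)

  bound : (∀ x y → Dec (Adj G x y)) → z ≤ n ∸ g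
  bound adj? with Exchange.privateMinimumDominating G adj? noIsolated D₀ D₀-minimum
  ... | D , (D-dom , _) , hasPrivate with zeroForcingFromPrivateNeighbours G D hasPrivate
  ... | B , B-forcing , ∣B∣≤n∸∣D∣ = begin
    z          ≤⟨ zMin B B-forcing ⟩
    ∣ B ∣      ≤⟨ ∣B∣≤n∸∣D∣ ⟩
    n ∸ ∣ D ∣  ≤⟨ ∸-monoʳ-≤ n (γMin D D-dom) ⟩
    n ∸ g      ∎
    where open ≤-Reasoning
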